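{- Let $p$ be an odd prime and $\mathbb{F}_p=\mathbb{Z}/p\mathbb{Z}$. For $t\in\mathbb{F}_p$, let $N_p(t)$ denote the number of pairs $(x,y)\in(\mathbb{F}_p^*)^2$ satisfying $x+\frac{1}{x}+y+\frac{1}{y}=t$. Then for every $t\in\mathbb{F}_p^*$, $N_p\!\left(\frac{16}{t}\right)\equiv N_p(t)\pmod p$.
   Context: $\mathbb{F}_p^*$ denotes the nonzero elements of $\mathbb{F}_p$, and $\frac1x$ denotes the multiplicative inverse of $x$ in $\mathbb{F}_p$. The integers $N_p(t)$ are regarded as integers when reduced modulo $p$. -}

module Defs where

open import Data.Nat using (ℕ; zero; suc; _+_; _*_; _∸_; NonZero)
open import Data.Nat.DivMod using (_%_)
open import Data.Nat.Primality using (Prime)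
open import Data.Nat.Properties using (_≟_)
open import Data.List using (List; upTo; length; filter; map; concatMap; _∷_; [])
open import Data.Product using (_×_; _,_)
open import Relation.Nullary using (¬_)
open import Relation.Binary.PropositionalEquality using (_≡_)

-- Elements of F_p = Z/pZ are represented by their residues 0,…,p-1 (naturals).
-- Congruence modulo p.
infix 4 _≡_[mod_]
_≡_[mod_] : ℕ → ℕ → (p : ℕ) → .{{NonZero p}} → Set
a ≡ b [mod p ] = a % p ≡ b % p

-- Multiplicative inverse in F_p: the least residue z ∈ {0,…,p-1} with
-- x * z ≡ 1 (mod p).  (For p prime and x ≢ 0 this is the unique inverse.)
-- If none exists (x ≡ 0) we return 0; this case is never used below.
firstInv : (p : ℕ) → .{{NonZero p}} → ℕ → List ℕ → ℕ
firstInv p x [] = 0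
firstInv p x (z ∷ zs) with (x * z) % p ≟ 1 % p
... | Relation.Nullary.yes _ = z
... | Relation.Nullary.no _ = firstInv p x zs

inv : (p : ℕ) → .{{NonZero p}} → ℕ → ℕ
inv p x = firstInv p x (upTo p)

nonzeroResidues : ℕ → List ℕ
nonzeroResidues p = map suc (upTo (p ∸ 1))

pairs : ℕ → List (ℕ × ℕ)
pairs p = concatMap (λ x → map (λ y → (x , y)) (nonzeroResidues p)) (nonzeroResidues p)

N : (p : ℕ) → .{{NonZero p}} → ℕ → ℕ
N p t = length (filter (λ { (x , y) → ((x + inv p x + y + inv p y) % p) ≟ (t % p) }) (pairs p))

-- Let R(z) = #{x ∈ F_p^* : x + 1/x = z} and S(z) = #{m : m² = z} = 1 + (z/p). The map x ↦ x - 1/x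
-- identifies R(z) with S(z² - 4), and N(t) = ∑_u R(u) R(t - u). Multiplicativity of the Legendre
-- symbol together with ∑_u R(u) = p - 1 turns this into N(t) + 2 = ∑_u S((u² - 4)((t - u)² - 4)).
-- The substitution u ↦ (4u + 8 - 2t)/t carries the summand for 16/t to (16/t²)² times the summand
-- for t, and S is unchanged by square factors, so N(16/t) = N(t) holds exactly, not only modulo p.
module Submission where

open import Defs
open import Data.Nat.Primality using (Prime)
open import Relation.Nullary using (¬_)
open import Data.Nat.DivMod using (_%_)
open import Relation.Binary.PropositionalEquality using (_≡_)
open import Data.Nat using (ℕ; NonZero)

module FiniteSums where
  open import Data.Nat using (zero; suc; _+_; _*_; _≤_; _<_; z≤n; s≤s)
  open import Data.Nat.Properties
  open import Data.List.Properties using (filter-++; length-++)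
  open import Data.List using (List; length; filter; applyUpTo; concatMap; _++_)
  open import Data.Product using (∃-syntax; _×_; _,_; proj₁; proj₂)
  open import Relation.Nullary using (Dec; yes; no; contradiction)
  open import Relation.Binary.PropositionalEquality using (_≢_; refl; sym; trans; cong; cong₂; subst; module ≡-Reasoning)
  open import Data.Nat.Tactic.RingSolver using (solve-∀)

  ∑ : ℕ → (ℕ → ℕ) → ℕ
  ∑ zero f = 0
  ∑ (suc n) f = f 0 + ∑ n (λ i → f (suc i))

  𝟙 : ∀ {A : Set} → Dec A → ℕ
  𝟙 (yes _) = 1
  𝟙 (no _) = 0

  𝟙-yes : ∀ {A : Set} (d : Dec A) → A → 𝟙 d ≡ 1
  𝟙-yes (yes _) _ = refl
  𝟙-yes (no ¬a) a = contradiction a ¬a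

  𝟙-no : ∀ {A : Set} (d : Dec A) → ¬ A → 𝟙 d ≡ 0
  𝟙-no (yes a) ¬a = contradiction a ¬a
  𝟙-no (no _) _ = refl

  𝟙≢0⇒ : ∀ {A : Set} (d : Dec A) → ¬ 𝟙 d ≡ 0 → A
  𝟙≢0⇒ (yes a) _ = a
  𝟙≢0⇒ (no _) 𝟙≢0 = contradiction refl 𝟙≢0

  𝟙-cong : ∀ {A B : Set} (d : Dec A) (e : Dec B) → (A → B) → (B → A) → 𝟙 d ≡ 𝟙 e
  𝟙-cong d (yes b) _ g = 𝟙-yes d (g b)
  𝟙-cong d (no ¬b) f _ = 𝟙-no d (λ a → ¬b (f a))

  δ : ℕ → ℕ → ℕ
  δ i k = 𝟙 (i ≟ k)

  ∑-cong : ∀ n {f g : ℕ → ℕ} → (∀ i → i < n → f i ≡ g i) → ∑ n f ≡ ∑ n g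
  ∑-cong zero _ = refl
  ∑-cong (suc n) f≗g = cong₂ _+_ (f≗g 0 (s≤s z≤n)) (∑-cong n (λ i i<n → f≗g (suc i) (s≤s i<n)))

  ∑-distrib-+ : ∀ n (f g : ℕ → ℕ) → ∑ n (λ i → f i + g i) ≡ ∑ n f + ∑ n g
  ∑-distrib-+ zero f g = refl
  ∑-distrib-+ (suc n) f g rewrite ∑-distrib-+ n (λ i → f (suc i)) (λ i → g (suc i)) =
    interchange (f 0) (g 0) (∑ n (λ i → f (suc i))) (∑ n (λ i → g (suc i)))
    where
    interchange : ∀ a b c d → a + b + (c + d) ≡ a + c + (b + d)
    interchange = solve-∀

  *-distribˡ-∑ : ∀ n c (f : ℕ → ℕ) → ∑ n (λ i → c * f i) ≡ c * ∑ n f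
  *-distribˡ-∑ zero c f = sym (*-zeroʳ c)
  *-distribˡ-∑ (suc n) c f rewrite *-distribˡ-∑ n c (λ i → f (suc i)) = sym (*-distribˡ-+ c (f 0) _)

  *-distribʳ-∑ : ∀ n c (f : ℕ → ℕ) → ∑ n (λ i → f i * c) ≡ ∑ n f * c
  *-distribʳ-∑ zero c f = refl
  *-distribʳ-∑ (suc n) c f rewrite *-distribʳ-∑ n c (λ i → f (suc i)) = sym (*-distribʳ-+ c (f 0) _)

  ∑-const : ∀ n c → ∑ n (λ _ → c) ≡ n * c
  ∑-const zero c = refl
  ∑-const (suc n) c = cong (c +_) (∑-const n c)

  ∑-zero : ∀ n {f : ℕ → ℕ} → (∀ i → i < n → f i ≡ 0) → ∑ n f ≡ 0
  ∑-zero zero _ = refl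
  ∑-zero (suc n) f≗0 rewrite f≗0 0 (s≤s z≤n) = ∑-zero n (λ i i<n → f≗0 (suc i) (s≤s i<n))

  ∑-comm : ∀ n m (f : ℕ → ℕ → ℕ) → ∑ n (λ i → ∑ m (f i)) ≡ ∑ m (λ j → ∑ n (λ i → f i j))
  ∑-comm zero m f = sym (∑-zero m (λ _ _ → refl))
  ∑-comm (suc n) m f = begin
    ∑ m (f 0) + ∑ n (λ i → ∑ m (f (suc i)))     ≡⟨ cong (∑ m (f 0) +_) (∑-comm n m (λ i → f (suc i))) ⟩
    ∑ m (f 0) + ∑ m (λ j → ∑ n (λ i → f (suc i) j)) ≡⟨ sym (∑-distrib-+ m (f 0) _) ⟩
    ∑ m (λ j → f 0 j + ∑ n (λ i → f (suc i) j))   ∎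
    where open ≡-Reasoning

  ∑-single : ∀ n (f : ℕ → ℕ) k → k < n → (∀ i → i < n → i ≢ k → f i ≡ 0) → ∑ n f ≡ f k
  ∑-single (suc n) f zero _ f≗0 =
    trans (cong (f 0 +_) (∑-zero n (λ i i<n → f≗0 (suc i) (s≤s i<n) (λ ())))) (+-identityʳ (f 0))
  ∑-single (suc n) f (suc k) (s≤s k<n) f≗0 rewrite f≗0 0 (s≤s z≤n) (λ ()) =
    ∑-single n (λ i → f (suc i)) k k<n (λ i i<n i≢k → f≗0 (suc i) (s≤s i<n) (λ e → i≢k (suc-injective e)))

  ∑-mono-≤ : ∀ n {f g : ℕ → ℕ} → (∀ i → i < n → f i ≤ g i) → ∑ n f ≤ ∑ n g
  ∑-mono-≤ zero _ = z≤n
  ∑-mono-≤ (suc n) f≤g = +-mono-≤ (f≤g 0 (s≤s z≤n)) (∑-mono-≤ n (λ i i<n → f≤g (suc i) (s≤s i<n)))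

  private
    +-mono-≤-tight : ∀ {a b c d} → a ≤ b → c ≤ d → a + c ≡ b + d → a ≡ b × c ≡ d
    +-mono-≤-tight {a} {b} {c} {d} a≤b c≤d eq = a≡b , +-cancelˡ-≡ b c d (subst (λ x → x + c ≡ b + d) a≡b eq)
      where
      a≡b : a ≡ b
      a≡b = ≤-antisym a≤b (+-cancelʳ-≤ c b a (subst (b + c ≤_) (sym eq) (+-monoʳ-≤ b c≤d)))

  ∑-mono-≤-tight : ∀ n {f g : ℕ → ℕ} → (∀ i → i < n → f i ≤ g i) → ∑ n f ≡ ∑ n g →
                   ∀ i → i < n → f i ≡ g i
  ∑-mono-≤-tight (suc n) {f} {g} f≤g ∑f≡∑g i i<n
    with +-mono-≤-tight (f≤g 0 (s≤s z≤n)) (∑-mono-≤ n (λ j j<n → f≤g (suc j) (s≤s j<n))) ∑f≡∑g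
  ∑-mono-≤-tight (suc n) f≤g _ zero _ | f0≡g0 , _ = f0≡g0
  ∑-mono-≤-tight (suc n) f≤g _ (suc i) (s≤s i<n) | _ , rest =
    ∑-mono-≤-tight n (λ j j<n → f≤g (suc j) (s≤s j<n)) rest i i<n

  ∑≢0⇒∃≢0 : ∀ n (f : ℕ → ℕ) → ∑ n f ≢ 0 → ∃[ i ] (i < n × f i ≢ 0)
  ∑≢0⇒∃≢0 zero f ∑≢0 = contradiction refl ∑≢0
  ∑≢0⇒∃≢0 (suc n) f ∑≢0 with f 0 ≟ 0
  ... | no f0≢0 = 0 , s≤s z≤n , f0≢0
  ... | yes f0≡0 with ∑≢0⇒∃≢0 n (λ i → f (suc i)) (λ ∑≡0 → ∑≢0 (cong₂ _+_ f0≡0 ∑≡0))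
  ...   | i , i<n , fi≢0 = suc i , s≤s i<n , fi≢0

  private
    δ-term-transfer : ∀ (A B f g : ℕ → ℕ) x y → A x ≢ 0 → g (f x) ≡ x → B (f x) ≡ A x →
                      (B y ≢ 0 → f (g y) ≡ y) → A x * δ y (f x) ≡ B y * δ x (g y)
    δ-term-transfer A B f g x y Ax≢0 gfx≡x Bfx≡Ax fgy≡y = go (y ≟ f x) (x ≟ g y)
      where
      go : (d : Dec (y ≡ f x)) (e : Dec (x ≡ g y)) → A x * 𝟙 d ≡ B y * 𝟙 e
      go (yes refl) (yes _) = cong (_* 1) (sym Bfx≡Ax)
      go (yes refl) (no x≢gy) = contradiction (sym gfx≡x) x≢gy
      go (no _) (no _) = trans (*-zeroʳ (A x)) (sym (*-zeroʳ (B y)))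
      go (no y≢fx) (yes refl) with B y ≟ 0
      ... | yes By≡0 = trans (*-zeroʳ (A x)) (sym (cong (_* 1) By≡0))
      ... | no By≢0 = contradiction (sym (fgy≡y By≢0)) y≢fx

    ∑-spread : ∀ n m (A f : ℕ → ℕ) → (∀ x → x < n → A x ≢ 0 → f x < m) →
               ∑ n A ≡ ∑ n (λ x → ∑ m (λ y → A x * δ y (f x)))
    ∑-spread n m A f f<m = ∑-cong n spread
      where
      spread : ∀ x → x < n → A x ≡ ∑ m (λ y → A x * δ y (f x))
      spread x x<n with A x ≟ 0
      ... | yes Ax≡0 = trans Ax≡0 (sym (∑-zero m (λ y _ → cong (_* δ y (f x)) Ax≡0)))
      ... | no Ax≢0 = sym (begin
        ∑ m (λ y → A x * δ y (f x)) ≡⟨ *-distribˡ-∑ m (A x) (λ y → δ y (f x)) ⟩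
        A x * ∑ m (λ y → δ y (f x)) ≡⟨ cong (A x *_) (∑-single m _ (f x) (f<m x x<n Ax≢0) δ-off) ⟩
        A x * δ (f x) (f x)         ≡⟨ cong (A x *_) (𝟙-yes (f x ≟ f x) refl) ⟩
        A x * 1                     ≡⟨ *-identityʳ (A x) ⟩
        A x                         ∎)
        where
        open ≡-Reasoning
        δ-off : ∀ y → y < m → y ≢ f x → δ y (f x) ≡ 0
        δ-off y _ = 𝟙-no (y ≟ f x)

  ∑-support-bijection : ∀ n m (A B f g : ℕ → ℕ) →
    (∀ x → x < n → A x ≢ 0 → f x < m × g (f x) ≡ x × B (f x) ≡ A x) →
    (∀ y → y < m → B y ≢ 0 → g y < n × f (g y) ≡ y × A (g y) ≡ B y) →
    ∑ n A ≡ ∑ m B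
  ∑-support-bijection n m A B f g onA onB = begin
    ∑ n A                                         ≡⟨ ∑-spread n m A f (λ x x<n Ax≢0 → proj₁ (onA x x<n Ax≢0)) ⟩
    ∑ n (λ x → ∑ m (λ y → A x * δ y (f x)))       ≡⟨ ∑-comm n m _ ⟩
    ∑ m (λ y → ∑ n (λ x → A x * δ y (f x)))       ≡⟨ ∑-cong m (λ y y<m → ∑-cong n (λ x x<n → transfer x y x<n y<m)) ⟩
    ∑ m (λ y → ∑ n (λ x → B y * δ x (g y)))       ≡⟨ sym (∑-spread m n B g (λ y y<m By≢0 → proj₁ (onB y y<m By≢0))) ⟩
    ∑ m B                                         ∎
    where
    open ≡-Reasoning
    transfer : ∀ x y → x < n → y < m → A x * δ y (f x) ≡ B y * δ x (g y)
    transfer x y x<n y<m with A x ≟ 0 | B y ≟ 0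
    ... | no Ax≢0 | _ = let (_ , gfx≡x , Bfx≡Ax) = onA x x<n Ax≢0 in
      δ-term-transfer A B f g x y Ax≢0 gfx≡x Bfx≡Ax (λ By≢0 → proj₁ (proj₂ (onB y y<m By≢0)))
    ... | yes _ | no By≢0 = let (_ , fgy≡y , Agy≡By) = onB y y<m By≢0 in
      sym (δ-term-transfer B A g f y x By≢0 fgy≡y Agy≡By (λ Ax≢0 → proj₁ (proj₂ (onA x x<n Ax≢0))))
    ... | yes Ax≡0 | yes By≡0 rewrite Ax≡0 | By≡0 = refl

  ∑-reindex : ∀ n (G φ ψ : ℕ → ℕ) → (∀ u → u < n → φ u < n) → (∀ w → w < n → ψ w < n) →
              (∀ u → u < n → ψ (φ u) ≡ u) → (∀ w → w < n → φ (ψ w) ≡ w) →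
              ∑ n (λ u → G (φ u)) ≡ ∑ n G
  ∑-reindex n G φ ψ φ<n ψ<n ψ∘φ≗id φ∘ψ≗id = ∑-support-bijection n n (λ u → G (φ u)) G φ ψ
    (λ u u<n _ → φ<n u u<n , ψ∘φ≗id u u<n , refl)
    (λ w w<n _ → ψ<n w w<n , φ∘ψ≗id w w<n , cong G (φ∘ψ≗id w w<n))

  length-filter-applyUpTo : ∀ {A : Set} {P : A → Set} (P? : ∀ a → Dec (P a)) (g : ℕ → A) n →
                            length (filter P? (applyUpTo g n)) ≡ ∑ n (λ i → 𝟙 (P? (g i)))
  length-filter-applyUpTo P? g zero = refl
  length-filter-applyUpTo P? g (suc n) with P? (g 0)
  ... | yes _ = cong suc (length-filter-applyUpTo P? (λ i → g (suc i)) n)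
  ... | no _ = length-filter-applyUpTo P? (λ i → g (suc i)) n

  length-filter-concatMap : ∀ {A B : Set} {P : A → Set} (P? : ∀ a → Dec (P a)) (F : B → List A) (g : ℕ → B) n →
                            length (filter P? (concatMap F (applyUpTo g n))) ≡ ∑ n (λ i → length (filter P? (F (g i))))
  length-filter-concatMap P? F g zero = refl
  length-filter-concatMap {A} P? F g (suc n) = begin
    length (filter P? (F (g 0) ++ rest))             ≡⟨ cong length (filter-++ P? (F (g 0)) rest) ⟩
    length (filter P? (F (g 0)) ++ filter P? rest)   ≡⟨ length-++ (filter P? (F (g 0))) ⟩
    length (filter P? (F (g 0))) + length (filter P? rest)
      ≡⟨ cong (length (filter P? (F (g 0))) +_) (length-filter-concatMap P? F (λ i → g (suc i)) n) ⟩
    ∑ (suc n) (λ i → length (filter P? (F (g i)))) ∎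
    where
    open ≡-Reasoning
    rest : List A
    rest = concatMap F (applyUpTo (λ i → g (suc i)) n)

open FiniteSums

module Congruence (p : ℕ) .{{_ : NonZero p}} where
  open import Data.Nat as ℕ using (_≤_; _<_)
  import Data.Nat.Properties as ℕ
  import Data.Nat.Divisibility as ℕ
  open import Data.Nat.DivMod using (_/_; m≡m%n+[m/n]*n; [m+kn]%n≡m%n; m<n⇒m%n≡m)
  open import Data.Integer using (ℤ; +_; -_; _+_; _*_; _-_; ∣_∣)
  open import Data.Integer.Properties using (pos-+; pos-*; m-n≡m⊖n; ∣⊖∣-≤; +-inverseʳ)
  open import Data.Integer.Divisibility.Signed using (_∣_; divides; _∣?_; ∣m∣n⇒∣m+n; ∣m⇒∣-m; ∣n⇒∣m*n; ∣m⇒∣m*n; ∣⇒∣ᵤ)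
  open import Data.Integer.DivMod using (_%ℕ_; _/ℕ_; n%ℕd<d; a≡a%ℕn+[a/ℕn]*n)
  open import Data.Integer.Tactic.RingSolver using (solve-∀)
  open import Data.Sum using (inj₁; inj₂)
  open import Relation.Nullary using (Dec)
  open import Relation.Nullary.Decidable using (map′)
  open import Relation.Binary.Bundles using (Setoid)
  open import Relation.Binary.PropositionalEquality using (_≢_; refl; sym; trans; cong; subst; module ≡-Reasoning)

  -- A record rather than a synonym for divisibility, so that a and b are inferable from a proof.
  infix 4 _≋_
  record _≋_ (a b : ℤ) : Set where
    constructor mk≋
    field divides-difference : + p ∣ a - b

  infix 4 _≋?_
  _≋?_ : (a b : ℤ) → Dec (a ≋ b)
  a ≋? b = map′ mk≋ _≋_.divides-difference (+ p ∣? a - b)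

  ≋-refl : ∀ {a} → a ≋ a
  ≋-refl {a} = mk≋ (divides (+ 0) (+-inverseʳ a))

  ≋-reflexive : ∀ {a b} → a ≡ b → a ≋ b
  ≋-reflexive refl = ≋-refl

  ≋-sym : ∀ {a b} → a ≋ b → b ≋ a
  ≋-sym {a} {b} (mk≋ p∣a-b) = mk≋ (subst (+ p ∣_) (neg-sub a b) (∣m⇒∣-m p∣a-b))
    where
    neg-sub : ∀ a b → - (a - b) ≡ b - a
    neg-sub = solve-∀

  ≋-trans : ∀ {a b c} → a ≋ b → b ≋ c → a ≋ c
  ≋-trans {a} {b} {c} (mk≋ p∣a-b) (mk≋ p∣b-c) = mk≋ (subst (+ p ∣_) (telescope a b c) (∣m∣n⇒∣m+n p∣a-b p∣b-c))
    where
    telescope : ∀ a b c → (a - b) + (b - c) ≡ a - c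
    telescope = solve-∀

  ≋-setoid : Setoid _ _
  ≋-setoid = record { Carrier = ℤ ; _≈_ = _≋_
                    ; isEquivalence = record { refl = ≋-refl ; sym = ≋-sym ; trans = ≋-trans } }

  +-cong : ∀ {a b c d} → a ≋ b → c ≋ d → a + c ≋ b + d
  +-cong {a} {b} {c} {d} (mk≋ p∣a-b) (mk≋ p∣c-d) = mk≋ (subst (+ p ∣_) (regroup a b c d) (∣m∣n⇒∣m+n p∣a-b p∣c-d))
    where
    regroup : ∀ a b c d → (a - b) + (c - d) ≡ (a + c) - (b + d)
    regroup = solve-∀

  *-cong : ∀ {a b c d} → a ≋ b → c ≋ d → a * c ≋ b * d
  *-cong {a} {b} {c} {d} (mk≋ p∣a-b) (mk≋ p∣c-d) =
    mk≋ (subst (+ p ∣_) (regroup a b c d) (∣m∣n⇒∣m+n (∣m⇒∣m*n c p∣a-b) (∣n⇒∣m*n b p∣c-d)))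
    where
    regroup : ∀ a b c d → (a - b) * c + b * (c - d) ≡ a * c - b * d
    regroup = solve-∀

  -‿cong : ∀ {a b} → a ≋ b → - a ≋ - b
  -‿cong {a} {b} (mk≋ p∣a-b) = mk≋ (subst (+ p ∣_) (regroup a b) (∣m⇒∣-m p∣a-b))
    where
    regroup : ∀ a b → - (a - b) ≡ - a - - b
    regroup = solve-∀

  *-congˡ : ∀ c {a b} → a ≋ b → c * a ≋ c * b
  *-congˡ c = *-cong (≋-refl {c})

  *-congʳ : ∀ c {a b} → a ≋ b → a * c ≋ b * c
  *-congʳ c a≋b = *-cong a≋b (≋-refl {c})

  ≋-+-multiple : ∀ a k → a + k * + p ≋ a
  ≋-+-multiple a k = mk≋ (divides k (cancel a (k * + p)))
    where
    cancel : ∀ a b → a + b - a ≡ b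
    cancel = solve-∀

  private
    ≤∧≋⇒%≡ : ∀ {m n} → m ≤ n → + m ≋ + n → m % p ≡ n % p
    ≤∧≋⇒%≡ {m} {n} m≤n (mk≋ p∣m-n) with ∣⇒∣ᵤ p∣m-n
    ... | ℕ.divides k ∣m-n∣≡kp = begin
      m % p                 ≡⟨ sym ([m+kn]%n≡m%n m k p) ⟩
      (m ℕ.+ k ℕ.* p) % p   ≡⟨ cong (λ d → (m ℕ.+ d) % p) n∸m≡kp ⟨
      (m ℕ.+ (n ℕ.∸ m)) % p ≡⟨ cong (_% p) (ℕ.m+[n∸m]≡n m≤n) ⟩
      n % p                 ∎
      where
      open ≡-Reasoning
      n∸m≡kp : n ℕ.∸ m ≡ k ℕ.* p
      n∸m≡kp = trans (sym (trans (cong ∣_∣ (m-n≡m⊖n m n)) (∣⊖∣-≤ m≤n))) ∣m-n∣≡kp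

  ≋⇒%≡ : ∀ {m n} → + m ≋ + n → m % p ≡ n % p
  ≋⇒%≡ {m} {n} m≋n with ℕ.≤-total m n
  ... | inj₁ m≤n = ≤∧≋⇒%≡ m≤n m≋n
  ... | inj₂ n≤m = sym (≤∧≋⇒%≡ n≤m (≋-sym m≋n))

  ≋-% : ∀ m → + m ≋ + (m % p)
  ≋-% m = ≋-trans (≋-reflexive (begin
    + m                                  ≡⟨ cong +_ (m≡m%n+[m/n]*n m p) ⟩
    + (m % p ℕ.+ (m / p) ℕ.* p)          ≡⟨ pos-+ (m % p) ((m / p) ℕ.* p) ⟩
    + (m % p) + + ((m / p) ℕ.* p)        ≡⟨ cong (λ k → + (m % p) + k) (pos-* (m / p) p) ⟩
    + (m % p) + + (m / p) * + p          ∎))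
    (≋-+-multiple (+ (m % p)) (+ (m / p)))
    where open ≡-Reasoning

  %≡⇒≋ : ∀ {m n} → m % p ≡ n % p → + m ≋ + n
  %≡⇒≋ {m} {n} eq = ≋-trans (≋-% m) (≋-trans (≋-reflexive (cong +_ eq)) (≋-sym (≋-% n)))

  residue : ℤ → ℕ
  residue a = a %ℕ p

  residue<p : ∀ a → residue a < p
  residue<p a = n%ℕd<d a p

  ≋-residue : ∀ a → a ≋ + residue a
  ≋-residue a = ≋-trans (≋-reflexive (a≡a%ℕn+[a/ℕn]*n a p)) (≋-+-multiple (+ residue a) (a /ℕ p))

  ≋-residue-unique : ∀ {u v} → u < p → v < p → + u ≋ + v → u ≡ v
  ≋-residue-unique {u} {v} u<p v<p u≋v = trans (sym (m<n⇒m%n≡m u<p)) (trans (≋⇒%≡ u≋v) (m<n⇒m%n≡m v<p))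

  residue-cong : ∀ {a b} → a ≋ b → residue a ≡ residue b
  residue-cong {a} {b} a≋b = ≋-residue-unique (residue<p a) (residue<p b)
    (≋-trans (≋-sym (≋-residue a)) (≋-trans a≋b (≋-residue b)))

  residue-of-residue : ∀ {u} → u < p → residue (+ u) ≡ u
  residue-of-residue = m<n⇒m%n≡m

  ∑-select-residue : ∀ a (g : ℕ → ℕ) → ∑ p (λ u → 𝟙 (a ≋? + u) ℕ.* g u) ≡ g (residue a)
  ∑-select-residue a g = begin
    ∑ p (λ u → 𝟙 (a ≋? + u) ℕ.* g u)               ≡⟨ ∑-single p _ (residue a) (residue<p a) off ⟩
    𝟙 (a ≋? + residue a) ℕ.* g (residue a)         ≡⟨ cong (ℕ._* g (residue a)) (𝟙-yes (a ≋? + residue a) (≋-residue a)) ⟩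
    1 ℕ.* g (residue a)                            ≡⟨ ℕ.*-identityˡ _ ⟩
    g (residue a)                                  ∎
    where
    open ≡-Reasoning
    off : ∀ u → u < p → u ≢ residue a → 𝟙 (a ≋? + u) ℕ.* g u ≡ 0
    off u u<p u≢ra = cong (ℕ._* g u) (𝟙-no (a ≋? + u) (λ a≋u →
      u≢ra (≋-residue-unique u<p (residue<p a) (≋-trans (≋-sym a≋u) (≋-residue a)))))

  ∑-𝟙-≋ : ∀ a → ∑ p (λ u → 𝟙 (a ≋? + u)) ≡ 1
  ∑-𝟙-≋ a = trans (∑-cong p (λ u _ → sym (ℕ.*-identityʳ _))) (∑-select-residue a (λ _ → 1))

module PrimeField (p : ℕ) .{{_ : NonZero p}} (p-prime : Prime p) where
  open Congruence p public
  open import Data.Nat as ℕ using (suc; _<_)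
  import Data.Nat.Properties as ℕ
  import Data.Nat.Divisibility as ℕ
  open import Data.Nat.Primality using (euclidsLemma; prime⇒nonTrivial)
  open import Data.Nat.Coprimality using (prime⇒coprime; coprime-Bézout)
  open import Data.Nat.GCD using (module Bézout)
  open import Data.Integer using (ℤ; +_; -_; _+_; _*_; _-_; ∣_∣)
  open import Data.Integer.Properties using (pos-+; pos-*; +-identityʳ; *-identityˡ; *-zeroʳ; abs-*)
  open import Data.Integer.Divisibility.Signed using (_∣_; ∣⇒∣ᵤ; ∣ᵤ⇒∣)
  open import Data.Integer.Tactic.RingSolver using (solve-∀)
  open import Data.List using (List; _∷_; upTo)
  open import Data.List.Relation.Unary.Any using (Any; here; there)
  open import Data.List.Relation.Unary.Any.Properties using (applyUpTo⁺)
  open import Data.Product using (∃-syntax; _,_)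
  open import Data.Sum using (_⊎_; inj₁; inj₂)
  open import Relation.Nullary using (yes; no; contradiction)
  open import Relation.Binary.PropositionalEquality using (sym; trans; cong; subst; module ≡-Reasoning)
  import Relation.Binary.Reasoning.Setoid as SetoidReasoning

  infix 4 _≉_
  _≉_ : ℤ → ℤ → Set
  a ≉ b = ¬ a ≋ b

  1<p : 1 < p
  1<p = ℕ.nonTrivial⇒n>1 p {{prime⇒nonTrivial p-prime}}

  ≋0⇒∣ : ∀ {a} → a ≋ + 0 → + p ∣ a
  ≋0⇒∣ {a} (mk≋ p∣a-0) = subst (+ p ∣_) (+-identityʳ a) p∣a-0

  ∣⇒≋0 : ∀ {a} → + p ∣ a → a ≋ + 0
  ∣⇒≋0 {a} p∣a = mk≋ (subst (+ p ∣_) (sym (+-identityʳ a)) p∣a)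

  ≋0-split : ∀ a b → a * b ≋ + 0 → a ≋ + 0 ⊎ b ≋ + 0
  ≋0-split a b ab≋0 with euclidsLemma ∣ a ∣ ∣ b ∣ p-prime (subst (p ℕ.∣_) (abs-* a b) (∣⇒∣ᵤ (≋0⇒∣ ab≋0)))
  ... | inj₁ p∣a = inj₁ (∣⇒≋0 (∣ᵤ⇒∣ p∣a))
  ... | inj₂ p∣b = inj₂ (∣⇒≋0 (∣ᵤ⇒∣ p∣b))

  *-≉0 : ∀ {a b} → a ≉ + 0 → b ≉ + 0 → a * b ≉ + 0
  *-≉0 {a} {b} a≉0 b≉0 ab≋0 with ≋0-split a b ab≋0
  ... | inj₁ a≋0 = a≉0 a≋0
  ... | inj₂ b≋0 = b≉0 b≋0

  *-≋0ˡ : ∀ {a} b → a ≋ + 0 → a * b ≋ + 0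
  *-≋0ˡ b a≋0 = *-congʳ b a≋0

  *-≋0ʳ : ∀ a {b} → b ≋ + 0 → a * b ≋ + 0
  *-≋0ʳ a b≋0 = ≋-trans (*-congˡ a b≋0) (≋-reflexive (*-zeroʳ a))

  private
    residue-inverse : ∀ u → 0 < u → u < p → ∃[ b ] (+ u * b ≋ + 1)
    residue-inverse u@(suc _) _ u<p with coprime-Bézout (prime⇒coprime p-prime u<p)
    ... | Bézout.+- x y 1+yu≡xp = - + y , ≋-trans (≋-reflexive (begin
      + u * - + y                       ≡⟨ rearrange (+ u) (+ y) ⟩
      + 1 - (+ 1 + + y * + u)            ≡⟨ cong (λ k → + 1 - (+ 1 + k)) (pos-* y u) ⟨
      + 1 - (+ 1 + + (y ℕ.* u))          ≡⟨ cong (λ k → + 1 - k) (pos-+ 1 (y ℕ.* u)) ⟨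
      + 1 - + (1 ℕ.+ y ℕ.* u)            ≡⟨ cong (λ k → + 1 - + k) 1+yu≡xp ⟩
      + 1 - + (x ℕ.* p)                  ≡⟨ cong (λ k → + 1 - k) (pos-* x p) ⟩
      + 1 - + x * + p                    ≡⟨ negate-left (+ 1) (+ x) (+ p) ⟩
      + 1 + (- + x) * + p                ∎)) (≋-+-multiple (+ 1) (- + x))
      where
      open ≡-Reasoning
      rearrange : ∀ u y → u * - y ≡ + 1 - (+ 1 + y * u)
      rearrange = solve-∀
      negate-left : ∀ a x p → a - x * p ≡ a + (- x) * p
      negate-left = solve-∀
    ... | Bézout.-+ x y 1+xp≡yu = + y , ≋-trans (≋-reflexive (begin
      + u * + y                          ≡⟨ pos-* u y ⟨
      + (u ℕ.* y)                        ≡⟨ cong +_ (ℕ.*-comm u y) ⟩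
      + (y ℕ.* u)                        ≡⟨ cong +_ 1+xp≡yu ⟨
      + (1 ℕ.+ x ℕ.* p)                  ≡⟨ pos-+ 1 (x ℕ.* p) ⟩
      + 1 + + (x ℕ.* p)                  ≡⟨ cong (λ k → + 1 + k) (pos-* x p) ⟩
      + 1 + + x * + p                    ∎)) (≋-+-multiple (+ 1) (+ x))
      where open ≡-Reasoning

  inverse : ∀ a → a ≉ + 0 → ∃[ b ] (a * b ≋ + 1)
  inverse a a≉0 with residue a ℕ.≟ 0
  ... | yes ra≡0 = contradiction (≋-trans (≋-residue a) (≋-reflexive (cong +_ ra≡0))) a≉0
  ... | no ra≢0 with residue-inverse (residue a) (ℕ.n≢0⇒n>0 ra≢0) (residue<p a)
  ...   | b , rab≋1 = b , ≋-trans (*-congʳ b (≋-residue a)) rab≋1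

  inverse-unique : ∀ {a b c} → a * b ≋ + 1 → a * c ≋ + 1 → b ≋ c
  inverse-unique {a} {b} {c} ab≋1 ac≋1 = begin
    b            ≡⟨ unitʳ b ⟩
    b * + 1      ≈⟨ *-congˡ b ac≋1 ⟨
    b * (a * c)  ≡⟨ regroup a b c ⟩
    (a * b) * c  ≈⟨ *-congʳ c ab≋1 ⟩
    + 1 * c      ≡⟨ *-identityˡ c ⟩
    c            ∎
    where
    open SetoidReasoning ≋-setoid
    unitʳ : ∀ b → b ≡ b * + 1
    unitʳ = solve-∀
    regroup : ∀ a b c → b * (a * c) ≡ (a * b) * c
    regroup = solve-∀

  private
    firstInv-correct : ∀ x (zs : List ℕ) → Any (λ z → (x ℕ.* z) % p ≡ 1 % p) zs →
                       (x ℕ.* firstInv p x zs) % p ≡ 1 % p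
    firstInv-correct x (z ∷ zs) found with (x ℕ.* z) % p ℕ.≟ 1 % p
    ... | yes xz≡1 = xz≡1
    ... | no xz≢1 with found
    ...   | here xz≡1 = contradiction xz≡1 xz≢1
    ...   | there found′ = firstInv-correct x zs found′

  inv-correct : ∀ x → + x ≉ + 0 → + x * + inv p x ≋ + 1
  inv-correct x x≉0 with inverse (+ x) x≉0
  ... | b , xb≋1 = ≋-trans (≋-reflexive (sym (pos-* x (inv p x))))
                           (%≡⇒≋ (firstInv-correct x (upTo p) (applyUpTo⁺ (λ z → z) x·rb≡1 (residue<p b))))
    where
    x·rb≡1 : (x ℕ.* residue b) % p ≡ 1 % p
    x·rb≡1 = ≋⇒%≡ (≋-trans (≋-reflexive (pos-* x (residue b))) (≋-trans (*-congˡ (+ x) (≋-sym (≋-residue b))) xb≋1))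

  positive-residue-≉0 : ∀ {x} → 0 < x → x < p → + x ≉ + 0
  positive-residue-≉0 {suc x} _ x<p x≋0 with ≋-residue-unique x<p (ℕ.<-trans (ℕ.s≤s ℕ.z≤n) 1<p) x≋0
  ... | ()

  1≉0 : + 1 ≉ + 0
  1≉0 = positive-residue-≉0 (ℕ.s≤s ℕ.z≤n) 1<p

module SquareRoots (p : ℕ) .{{_ : NonZero p}} (p-prime : Prime p) (p-odd : p % 2 ≡ 1) where
  open PrimeField p p-prime public
  open import Data.Nat as ℕ using (_≤_; _<_)
  import Data.Nat.Properties as ℕ
  import Data.Nat.Divisibility as ℕ
  import Data.Nat.Tactic.RingSolver as ℕ-Solver
  open import Data.Integer using (ℤ; +_; -_; _+_; _*_; _-_)
  open import Data.Integer.Properties using (*-comm; *-identityˡ; +-identityˡ; +-inverseʳ; +-inverseˡ)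
  open import Data.Integer.Divisibility.Signed using (∣⇒∣ᵤ)
  open import Data.Integer.Tactic.RingSolver using (solve-∀)
  open import Data.Product using (∃-syntax; _,_; proj₁; proj₂)
  open import Data.Sum using (_⊎_; inj₁; inj₂; [_,_])
  import Data.Sum as Sum
  open import Relation.Nullary using (yes; no; contradiction)
  open import Relation.Binary.PropositionalEquality using (refl; sym; trans; cong; cong₂; subst; module ≡-Reasoning)
  import Relation.Binary.Reasoning.Setoid as SetoidReasoning

  2≉0 : + 2 ≉ + 0
  2≉0 2≋0 = contradiction (trans (sym p-odd) (cong (_% 2) p≡2)) (λ ())
    where
    p≡2 : p ≡ 2
    p≡2 = ℕ.≤-antisym (ℕ.∣⇒≤ (∣⇒∣ᵤ (≋0⇒∣ 2≋0))) 1<p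

  4≉0 : + 4 ≉ + 0
  4≉0 = *-≉0 2≉0 2≉0

  16≉0 : + 16 ≉ + 0
  16≉0 = *-≉0 4≉0 4≉0

  sqrtCount : ℤ → ℕ
  sqrtCount z = ∑ p (λ m → 𝟙 (+ m * + m ≋? z))

  sqrtCount-cong : ∀ {a b} → a ≋ b → sqrtCount a ≡ sqrtCount b
  sqrtCount-cong a≋b = ∑-cong p (λ m _ → 𝟙-cong (_ ≋? _) (_ ≋? _)
    (λ m²≋a → ≋-trans m²≋a a≋b) (λ m²≋b → ≋-trans m²≋b (≋-sym a≋b)))

  square-≋0 : ∀ {c} → c * c ≋ + 0 → c ≋ + 0
  square-≋0 {c} c²≋0 with ≋0-split c c c²≋0
  ... | inj₁ c≋0 = c≋0
  ... | inj₂ c≋0 = c≋0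

  square-roots : ∀ {c m} → m * m ≋ c * c → m ≋ c ⊎ m ≋ - c
  square-roots {c} {m} m²≋c² = Sum.map (shift c) (shift (- c)) (≋0-split (m - c) (m - - c) product≋0)
    where
    factor : ∀ m c → (m - c) * (m - - c) ≡ m * m - c * c
    factor = solve-∀
    product≋0 : (m - c) * (m - - c) ≋ + 0
    product≋0 = ≋-trans (≋-reflexive (factor m c)) (≋-trans (+-cong m²≋c² (≋-refl { - (c * c)})) (≋-reflexive (+-inverseʳ (c * c))))
    cancel : ∀ m d → m - d + d ≡ m
    cancel = solve-∀
    shift : ∀ d → m - d ≋ + 0 → m ≋ d
    shift d m-d≋0 = ≋-trans (≋-reflexive (sym (cancel m d))) (≋-trans (+-cong m-d≋0 (≋-refl {d})) (≋-reflexive (+-identityˡ d)))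

  ≉0⇒≉-self : ∀ {c} → c ≉ + 0 → c ≉ - c
  ≉0⇒≉-self {c} c≉0 c≋-c = [ 2≉0 , c≉0 ] (≋0-split (+ 2) c 2c≋0)
    where
    double : ∀ c → + 2 * c ≡ c + c
    double = solve-∀
    2c≋0 : + 2 * c ≋ + 0
    2c≋0 = ≋-trans (≋-reflexive (double c)) (≋-trans (+-cong c≋-c (≋-refl {c})) (≋-reflexive (+-inverseˡ c)))

  sqrtCount-≋0 : ∀ {z} → z ≋ + 0 → sqrtCount z ≡ 1
  sqrtCount-≋0 {z} z≋0 = trans (∑-cong p (λ m _ → 𝟙-cong (_ ≋? z) (+ 0 ≋? + m) m≋0 m²≋z)) (∑-𝟙-≋ (+ 0))
    where
    m≋0 : ∀ {m} → + m * + m ≋ z → + 0 ≋ + m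
    m≋0 m²≋z = ≋-sym (square-≋0 (≋-trans m²≋z z≋0))
    m²≋z : ∀ {m} → + 0 ≋ + m → + m * + m ≋ z
    m²≋z 0≋m = ≋-trans (*-≋0ˡ _ (≋-sym 0≋m)) (≋-sym z≋0)

  sqrtCount-square : ∀ {z} c → z ≉ + 0 → c * c ≋ z → sqrtCount z ≡ 2
  sqrtCount-square {z} c z≉0 c²≋z = begin
    ∑ p (λ m → 𝟙 (+ m * + m ≋? z))                          ≡⟨ ∑-cong p (λ m _ → two-roots m) ⟩
    ∑ p (λ m → 𝟙 (c ≋? + m) ℕ.+ 𝟙 (- c ≋? + m))             ≡⟨ ∑-distrib-+ p _ _ ⟩
    ∑ p (λ m → 𝟙 (c ≋? + m)) ℕ.+ ∑ p (λ m → 𝟙 (- c ≋? + m)) ≡⟨ cong₂ ℕ._+_ (∑-𝟙-≋ c) (∑-𝟙-≋ (- c)) ⟩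
    2                                                        ∎
    where
    open ≡-Reasoning
    c≉-c : c ≉ - c
    c≉-c = ≉0⇒≉-self (λ c≋0 → z≉0 (≋-trans (≋-sym c²≋z) (*-≋0ˡ c c≋0)))
    square-of : ∀ {a m} → a ≋ + m → a * a ≋ z → + m * + m ≋ z
    square-of a≋m a²≋z = ≋-trans (*-cong (≋-sym a≋m) (≋-sym a≋m)) a²≋z
    -c²≋z : - c * - c ≋ z
    -c²≋z = ≋-trans (≋-reflexive (neg-square c)) c²≋z
      where
      neg-square : ∀ c → - c * - c ≡ c * c
      neg-square = solve-∀
    two-roots : ∀ m → 𝟙 (+ m * + m ≋? z) ≡ 𝟙 (c ≋? + m) ℕ.+ 𝟙 (- c ≋? + m)
    two-roots m with c ≋? + m | - c ≋? + m
    ... | yes c≋m | yes -c≋m = contradiction (≋-trans c≋m (≋-sym -c≋m)) c≉-c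
    ... | yes c≋m | no _ = 𝟙-yes (_ ≋? z) (square-of c≋m c²≋z)
    ... | no _ | yes -c≋m = 𝟙-yes (_ ≋? z) (square-of -c≋m -c²≋z)
    ... | no c≉m | no -c≉m = 𝟙-no (_ ≋? z) (λ m²≋z → [ (λ m≋c → c≉m (≋-sym m≋c)) , (λ m≋-c → -c≉m (≋-sym m≋-c)) ]
                                                      (square-roots (≋-trans m²≋z (≋-sym c²≋z))))

  sqrtCount-nonsquare : ∀ {z} → (∀ c → c * c ≉ z) → sqrtCount z ≡ 0
  sqrtCount-nonsquare no-root = ∑-zero p (λ m _ → 𝟙-no (_ ≋? _) (no-root (+ m)))

  data SquareClass (z : ℤ) : Set where
    zero      : z ≋ + 0 → SquareClass z
    square    : z ≉ + 0 → (c : ℤ) → c * c ≋ z → SquareClass z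
    nonsquare : z ≉ + 0 → (∀ c → c * c ≉ z) → SquareClass z

  classify : ∀ z → SquareClass z
  classify z with z ≋? + 0
  ... | yes z≋0 = zero z≋0
  ... | no z≉0 with sqrtCount z ℕ.≟ 0
  ...   | yes none = nonsquare z≉0 (λ c c²≋z → contradiction (trans (sym (sqrtCount-square c z≉0 c²≋z)) none) (λ ()))
  ...   | no some with ∑≢0⇒∃≢0 p _ some
  ...     | m , _ , m²≋z = square z≉0 (+ m) (𝟙≢0⇒ (_ ≋? z) m²≋z)

  square-cancel : ∀ {c z w y} → z ≉ + 0 → c * c ≋ z → w * w ≋ y * z → ∃[ s ] (s * s ≋ y)
  square-cancel {c} {z} {w} {y} z≉0 c²≋z w²≋yz = w * c⁻¹ , (begin
    (w * c⁻¹) * (w * c⁻¹)         ≡⟨ regroup₁ w c⁻¹ ⟩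
    (w * w) * (c⁻¹ * c⁻¹)         ≈⟨ *-congʳ (c⁻¹ * c⁻¹) (≋-trans w²≋yz (*-congˡ y (≋-sym c²≋z))) ⟩
    (y * (c * c)) * (c⁻¹ * c⁻¹)   ≡⟨ regroup₂ y c c⁻¹ ⟩
    y * ((c * c⁻¹) * (c * c⁻¹))   ≈⟨ *-congˡ y (*-cong cc⁻¹≋1 cc⁻¹≋1) ⟩
    y * (+ 1 * + 1)               ≡⟨ unit y ⟩
    y                             ∎)
    where
    open SetoidReasoning ≋-setoid
    c≉0 : c ≉ + 0
    c≉0 c≋0 = z≉0 (≋-trans (≋-sym c²≋z) (*-≋0ˡ c c≋0))
    c⁻¹ : ℤ
    c⁻¹ = proj₁ (inverse c c≉0)
    cc⁻¹≋1 : c * c⁻¹ ≋ + 1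
    cc⁻¹≋1 = proj₂ (inverse c c≉0)
    regroup₁ : ∀ w c⁻¹ → (w * c⁻¹) * (w * c⁻¹) ≡ (w * w) * (c⁻¹ * c⁻¹)
    regroup₁ = solve-∀
    regroup₂ : ∀ y c c⁻¹ → (y * (c * c)) * (c⁻¹ * c⁻¹) ≡ y * ((c * c⁻¹) * (c * c⁻¹))
    regroup₂ = solve-∀
    unit : ∀ y → y * (+ 1 * + 1) ≡ y
    unit = solve-∀

  sqrtCount≤2 : ∀ z → sqrtCount z ≤ 2
  sqrtCount≤2 z with classify z
  ... | zero z≋0 = ℕ.≤-trans (ℕ.≤-reflexive (sqrtCount-≋0 z≋0)) (ℕ.n≤1+n 1)
  ... | square z≉0 c c²≋z = ℕ.≤-reflexive (sqrtCount-square c z≉0 c²≋z)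
  ... | nonsquare _ no-root = ℕ.≤-trans (ℕ.≤-reflexive (sqrtCount-nonsquare no-root)) ℕ.z≤n

  ∑-sqrtCount-* : ∀ a → a ≉ + 0 → ∑ p (λ z → sqrtCount (a * + z)) ≡ p
  ∑-sqrtCount-* a a≉0 = begin
    ∑ p (λ z → ∑ p (λ m → 𝟙 (+ m * + m ≋? a * + z)))   ≡⟨ ∑-comm p p _ ⟩
    ∑ p (λ m → ∑ p (λ z → 𝟙 (+ m * + m ≋? a * + z)))   ≡⟨ ∑-cong p (λ m _ → ∑-cong p (λ z _ → 𝟙-cong (_ ≋? _) (_ ≋? _) (divide m z) (multiply m z))) ⟩
    ∑ p (λ m → ∑ p (λ z → 𝟙 (a⁻¹ * (+ m * + m) ≋? + z))) ≡⟨ ∑-cong p (λ m _ → ∑-𝟙-≋ (a⁻¹ * (+ m * + m))) ⟩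
    ∑ p (λ _ → 1)                                        ≡⟨ ∑-const p 1 ⟩
    p ℕ.* 1                                              ≡⟨ ℕ.*-identityʳ p ⟩
    p                                                    ∎
    where
    open ≡-Reasoning
    a⁻¹ : ℤ
    a⁻¹ = proj₁ (inverse a a≉0)
    aa⁻¹≋1 : a * a⁻¹ ≋ + 1
    aa⁻¹≋1 = proj₂ (inverse a a≉0)
    regroupˡ : ∀ a a⁻¹ z → a⁻¹ * (a * z) ≡ (a * a⁻¹) * z
    regroupˡ = solve-∀
    regroupʳ : ∀ a a⁻¹ z → a * (a⁻¹ * z) ≡ (a * a⁻¹) * z
    regroupʳ = solve-∀
    unit : ∀ {q} → (a * a⁻¹) * q ≋ q
    unit {q} = ≋-trans (*-congʳ q aa⁻¹≋1) (≋-reflexive (*-identityˡ q))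
    divide : ∀ m z → + m * + m ≋ a * + z → a⁻¹ * (+ m * + m) ≋ + z
    divide m z m²≋az = ≋-trans (*-congˡ a⁻¹ m²≋az) (≋-trans (≋-reflexive (regroupˡ a a⁻¹ (+ z))) unit)
    multiply : ∀ m z → a⁻¹ * (+ m * + m) ≋ + z → + m * + m ≋ a * + z
    multiply m z a⁻¹m²≋z = ≋-trans (≋-sym (≋-trans (≋-reflexive (regroupʳ a a⁻¹ (+ m * + m))) unit)) (*-congˡ a a⁻¹m²≋z)

  nonsquare-*-square : ∀ {a z c} → (∀ s → s * s ≉ a) → z ≉ + 0 → c * c ≋ z → ∀ w → w * w ≉ a * z
  nonsquare-*-square {a} {z} {c} no-root z≉0 c²≋z w w²≋az = no-root (proj₁ root) (proj₂ root)
    where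
    root : ∃[ s ] (s * s ≋ a)
    root = square-cancel {c} {z} {w} {a} z≉0 c²≋z w²≋az

  -- Since a is not a square, z and a z are never both nonzero squares, so every term of
  -- ∑_z (sqrtCount z + sqrtCount (a z)) = 2p is at most 2, hence equal to 2; take z = b.
  nonsquare-*-nonsquare : ∀ {a b} → a ≉ + 0 → (∀ c → c * c ≉ a) → (∀ c → c * c ≉ b) → sqrtCount (a * b) ≡ 2
  nonsquare-*-nonsquare {a} {b} a≉0 a-nonsquare b-nonsquare = begin
    sqrtCount (a * b)                        ≡⟨ sqrtCount-cong (*-congˡ a (≋-residue b)) ⟩
    sqrtCount (a * + rb)                     ≡⟨ trans (cong (ℕ._+ sqrtCount (a * + rb)) (sym Srb≡0)) (tight rb (residue<p b)) ⟩
    2                                        ∎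
    where
    open ≡-Reasoning
    rb : ℕ
    rb = residue b
    Srb≡0 : sqrtCount (+ rb) ≡ 0
    Srb≡0 = trans (sqrtCount-cong (≋-sym (≋-residue b))) (sqrtCount-nonsquare b-nonsquare)
    g : ℕ → ℕ
    g z = sqrtCount (+ z) ℕ.+ sqrtCount (a * + z)
    g≤2 : ∀ z → z < p → g z ≤ 2
    g≤2 z _ with classify (+ z)
    ... | zero z≋0 = ℕ.≤-reflexive (cong₂ ℕ._+_ (sqrtCount-≋0 z≋0) (sqrtCount-≋0 (*-≋0ʳ a z≋0)))
    ... | nonsquare _ z-nonsquare =
      subst (λ k → k ℕ.+ sqrtCount (a * + z) ≤ 2) (sym (sqrtCount-nonsquare z-nonsquare)) (sqrtCount≤2 (a * + z))
    ... | square z≉0 c c²≋z = ℕ.≤-reflexive (cong₂ ℕ._+_ (sqrtCount-square c z≉0 c²≋z)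
                                (sqrtCount-nonsquare (nonsquare-*-square {a} {+ z} {c} a-nonsquare z≉0 c²≋z)))
    ∑g≡∑2 : ∑ p g ≡ ∑ p (λ _ → 2)
    ∑g≡∑2 = begin
      ∑ p g                                                             ≡⟨ ∑-distrib-+ p _ _ ⟩
      ∑ p (λ z → sqrtCount (+ z)) ℕ.+ ∑ p (λ z → sqrtCount (a * + z))  ≡⟨ cong₂ ℕ._+_ ∑S (∑-sqrtCount-* a a≉0) ⟩
      p ℕ.+ p                                                           ≡⟨ double p ⟩
      p ℕ.* 2                                                           ≡⟨ ∑-const p 2 ⟨
      ∑ p (λ _ → 2)                                                     ∎
      where
      ∑S : ∑ p (λ z → sqrtCount (+ z)) ≡ p
      ∑S = trans (∑-cong p (λ z _ → sqrtCount-cong (≋-reflexive (sym (*-identityˡ (+ z)))))) (∑-sqrtCount-* (+ 1) 1≉0)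
      double : ∀ p → p ℕ.+ p ≡ p ℕ.* 2
      double = ℕ-Solver.solve-∀
    tight : ∀ z → z < p → g z ≡ 2
    tight = ∑-mono-≤-tight p g≤2 ∑g≡∑2

  private
    *-squares : ∀ {a b} c d → c * c ≋ a → d * d ≋ b → (c * d) * (c * d) ≋ a * b
    *-squares c d c²≋a d²≋b = ≋-trans (≋-reflexive (regroup c d)) (*-cong c²≋a d²≋b)
      where
      regroup : ∀ c d → (c * d) * (c * d) ≡ (c * c) * (d * d)
      regroup = solve-∀

    from-values : ∀ {a b c x y z} → a ≡ x → b ≡ y → c ≡ z → x ℕ.* y ℕ.+ 2 ≡ x ℕ.+ y ℕ.+ z →
                  a ℕ.* b ℕ.+ 2 ≡ a ℕ.+ b ℕ.+ c
    from-values refl refl refl eq = eq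

    one-*ˡ : ∀ y → 1 ℕ.* y ℕ.+ 2 ≡ 1 ℕ.+ y ℕ.+ 1
    one-*ˡ = ℕ-Solver.solve-∀

    one-*ʳ : ∀ x → x ℕ.* 1 ℕ.+ 2 ≡ x ℕ.+ 1 ℕ.+ 1
    one-*ʳ = ℕ-Solver.solve-∀

  -- With χ = sqrtCount - 1 (the Legendre symbol), this is χ (a b) = χ a χ b.
  sqrtCount-* : ∀ a b → sqrtCount a ℕ.* sqrtCount b ℕ.+ 2 ≡ sqrtCount a ℕ.+ sqrtCount b ℕ.+ sqrtCount (a * b)
  sqrtCount-* a b with classify a | classify b
  ... | zero a≋0 | _ =
    from-values (sqrtCount-≋0 a≋0) refl (sqrtCount-≋0 (*-≋0ˡ b a≋0)) (one-*ˡ (sqrtCount b))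
  ... | square _ _ _ | zero b≋0 =
    from-values refl (sqrtCount-≋0 b≋0) (sqrtCount-≋0 (*-≋0ʳ a b≋0)) (one-*ʳ (sqrtCount a))
  ... | nonsquare _ _ | zero b≋0 =
    from-values refl (sqrtCount-≋0 b≋0) (sqrtCount-≋0 (*-≋0ʳ a b≋0)) (one-*ʳ (sqrtCount a))
  ... | square a≉0 c c²≋a | square b≉0 d d²≋b =
    from-values (sqrtCount-square c a≉0 c²≋a) (sqrtCount-square d b≉0 d²≋b)
                (sqrtCount-square (c * d) (*-≉0 a≉0 b≉0) (*-squares {a} {b} c d c²≋a d²≋b)) refl
  ... | square a≉0 c c²≋a | nonsquare b≉0 b-nonsquare =
    from-values (sqrtCount-square c a≉0 c²≋a) (sqrtCount-nonsquare b-nonsquare)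
                (sqrtCount-nonsquare (λ w w²≋ab → nonsquare-*-square {b} {a} {c} b-nonsquare a≉0 c²≋a w
                                                    (≋-trans w²≋ab (≋-reflexive (*-comm a b))))) refl
  ... | nonsquare a≉0 a-nonsquare | square b≉0 d d²≋b =
    from-values (sqrtCount-nonsquare a-nonsquare) (sqrtCount-square d b≉0 d²≋b)
                (sqrtCount-nonsquare (nonsquare-*-square {a} {b} {d} a-nonsquare b≉0 d²≋b)) refl
  ... | nonsquare a≉0 a-nonsquare | nonsquare _ b-nonsquare =
    from-values (sqrtCount-nonsquare a-nonsquare) (sqrtCount-nonsquare b-nonsquare)
                (nonsquare-*-nonsquare {a} {b} a≉0 a-nonsquare b-nonsquare) refl

  sqrtCount-scale : ∀ k z → k ≉ + 0 → sqrtCount (k * k * z) ≡ sqrtCount z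
  sqrtCount-scale k z k≉0 with classify z
  ... | zero z≋0 = trans (sqrtCount-≋0 (*-≋0ʳ (k * k) z≋0)) (sym (sqrtCount-≋0 z≋0))
  ... | square z≉0 c c²≋z =
    trans (sqrtCount-square (k * c) (*-≉0 k²≉0 z≉0) (*-squares {k * k} {z} k c ≋-refl c²≋z))
          (sym (sqrtCount-square c z≉0 c²≋z))
    where
    k²≉0 : k * k ≉ + 0
    k²≉0 = *-≉0 k≉0 k≉0
  ... | nonsquare z≉0 z-nonsquare =
    trans (sqrtCount-nonsquare (λ w w²≋k²z → nonsquare-*-square {z} {k * k} {k} z-nonsquare (*-≉0 k≉0 k≉0) ≋-refl w
                                               (≋-trans w²≋k²z (≋-reflexive (*-comm (k * k) z)))))
          (sym (sqrtCount-nonsquare z-nonsquare))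

module JoukowskiCounts (p : ℕ) .{{_ : NonZero p}} (p-prime : Prime p) (p-odd : p % 2 ≡ 1) where
  open SquareRoots p p-prime p-odd
  open import Data.Nat as ℕ using (suc; pred; _∸_; _<_)
  import Data.Nat.Properties as ℕ
  import Data.Nat.Tactic.RingSolver as ℕ-Solver
  open import Data.Integer using (ℤ; +_; -_; _+_; _*_; _-_)
  open import Data.Integer.Properties using (*-identityʳ; *-comm; +-assoc; pos-+; pos-*)
  open import Data.Integer.Tactic.RingSolver using (solve-∀)
  open import Data.Product using (_×_; _,_; proj₁; proj₂)
  open import Data.List using (List; length; filter; map; concatMap; applyUpTo; upTo)
  open import Data.List.Properties using (map-applyUpTo)
  open import Relation.Nullary using (Dec)
  open import Relation.Binary.PropositionalEquality using (_≢_; refl; sym; trans; cong; cong₂; module ≡-Reasoning)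
  import Relation.Binary.Reasoning.Setoid as SetoidReasoning

  x+x⁻¹ : ℕ → ℤ
  x+x⁻¹ x = + x + + inv p x

  -- The element i + 1 of F_p^* is indexed by i < p - 1, as in nonzeroResidues.
  fibreCount : ℤ → ℕ
  fibreCount z = ∑ (p ∸ 1) (λ i → 𝟙 (x+x⁻¹ (suc i) ≋? z))

  private
    ½ : ℤ
    ½ = proj₁ (inverse (+ 2) 2≉0)

    2½≋1 : + 2 * ½ ≋ + 1
    2½≋1 = proj₂ (inverse (+ 2) 2≉0)

    difference-square : ∀ {x y z} → x * y ≋ + 1 → x + y ≋ z → (x - y) * (x - y) ≋ z * z - + 4
    difference-square {x} {y} {z} xy≋1 x+y≋z = begin
      (x - y) * (x - y)                       ≡⟨ expand x y ⟩
      (x + y) * (x + y) - + 4 * (x * y)       ≈⟨ +-cong (*-cong x+y≋z x+y≋z) (-‿cong (*-congˡ (+ 4) xy≋1)) ⟩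
      z * z - + 4 * + 1                       ≡⟨ cong (λ k → z * z - k) (*-identityʳ (+ 4)) ⟩
      z * z - + 4                             ∎
      where
      open SetoidReasoning ≋-setoid
      expand : ∀ x y → (x - y) * (x - y) ≡ (x + y) * (x + y) - + 4 * (x * y)
      expand = solve-∀

    half-of-sum : ∀ {x y z} → x + y ≋ z → (z + (x - y)) * ½ ≋ x
    half-of-sum {x} {y} {z} x+y≋z = begin
      (z + (x - y)) * ½               ≈⟨ *-congʳ ½ (+-cong (≋-sym x+y≋z) ≋-refl) ⟩
      ((x + y) + (x - y)) * ½         ≡⟨ regroup x y ½ ⟩
      x * (+ 2 * ½)                   ≈⟨ *-congˡ x 2½≋1 ⟩
      x * + 1                         ≡⟨ *-identityʳ x ⟩
      x                               ∎
      where
      open SetoidReasoning ≋-setoid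
      regroup : ∀ x y h → ((x + y) + (x - y)) * h ≡ x * (+ 2 * h)
      regroup = solve-∀

    conjugate-half : ∀ z m → z - (z + m) * ½ ≋ (z - m) * ½
    conjugate-half z m = begin
      z - (z + m) * ½                 ≡⟨ cong (λ k → k - (z + m) * ½) (*-identityʳ z) ⟨
      z * + 1 - (z + m) * ½           ≈⟨ +-cong (*-congˡ z (≋-sym 2½≋1)) ≋-refl ⟩
      z * (+ 2 * ½) - (z + m) * ½     ≡⟨ regroup z m ½ ⟩
      (z - m) * ½                     ∎
      where
      open SetoidReasoning ≋-setoid
      regroup : ∀ z m h → z * (+ 2 * h) - (z + m) * h ≡ (z - m) * h
      regroup = solve-∀

    half-sum-inverse : ∀ {z m} → m * m ≋ z * z - + 4 → (z + m) * ½ * (z - (z + m) * ½) ≋ + 1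
    half-sum-inverse {z} {m} m²≋z²-4 = begin
      (z + m) * ½ * (z - (z + m) * ½)   ≈⟨ *-congˡ ((z + m) * ½) (conjugate-half z m) ⟩
      (z + m) * ½ * ((z - m) * ½)       ≡⟨ regroup z m ½ ⟩
      (z * z - m * m) * (½ * ½)         ≈⟨ *-congʳ (½ * ½) z²-m²≋4 ⟩
      + 4 * (½ * ½)                     ≡⟨ split ½ ⟩
      (+ 2 * ½) * (+ 2 * ½)             ≈⟨ *-cong 2½≋1 2½≋1 ⟩
      + 1                               ∎
      where
      open SetoidReasoning ≋-setoid
      regroup : ∀ z m h → (z + m) * h * ((z - m) * h) ≡ (z * z - m * m) * (h * h)
      regroup = solve-∀
      split : ∀ h → + 4 * (h * h) ≡ (+ 2 * h) * (+ 2 * h)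
      split = solve-∀
      cancel : ∀ z → z * z - (z * z - + 4) ≡ + 4
      cancel = solve-∀
      z²-m²≋4 : z * z - m * m ≋ + 4
      z²-m²≋4 = ≋-trans (+-cong (≋-refl {z * z}) (-‿cong m²≋z²-4)) (≋-reflexive (cancel z))

    half-sum-difference : ∀ z m → (z + m) * ½ - (z - (z + m) * ½) ≋ m
    half-sum-difference z m = begin
      (z + m) * ½ - (z - (z + m) * ½)   ≡⟨ regroup z m ½ ⟩
      (z + m) * (+ 2 * ½) - z           ≈⟨ +-cong (*-congˡ (z + m) 2½≋1) ≋-refl ⟩
      (z + m) * + 1 - z                 ≡⟨ cancel z m ⟩
      m                                 ∎
      where
      open SetoidReasoning ≋-setoid
      regroup : ∀ z m h → (z + m) * h - (z - (z + m) * h) ≡ (z + m) * (+ 2 * h) - z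
      regroup = solve-∀
      cancel : ∀ z m → (z + m) * + 1 - z ≡ m
      cancel = solve-∀

  -- x ↦ x - 1/x and m ↦ (z + m)/2 are mutually inverse between the fibre over z and the
  -- square roots of z² - 4, because (x - 1/x)² = (x + 1/x)² - 4.
  fibreCount-discriminant : ∀ z → fibreCount z ≡ sqrtCount (z * z - + 4)
  fibreCount-discriminant z = ∑-support-bijection (p ∸ 1) p A B f g onA onB
    where
    A : ℕ → ℕ
    A i = 𝟙 (x+x⁻¹ (suc i) ≋? z)
    B : ℕ → ℕ
    B m = 𝟙 (+ m * + m ≋? z * z - + 4)
    f : ℕ → ℕ
    f i = residue (+ suc i - + inv p (suc i))
    X : ℕ → ℤ
    X m = (z + + m) * ½
    g : ℕ → ℕ
    g m = pred (residue (X m))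

    onA : ∀ i → i < p ∸ 1 → A i ≢ 0 → f i < p × g (f i) ≡ i × B (f i) ≡ A i
    onA i i<p-1 Ai≢0 = residue<p (+ x - + inv p x) , cong pred (trans (residue-cong X≋x) (residue-of-residue x<p))
                     , trans (𝟙-yes (+ f i * + f i ≋? z * z - + 4) fi²≋z²-4) (sym (𝟙-yes (x+x⁻¹ x ≋? z) x+x⁻¹≋z))
      where
      x : ℕ
      x = suc i
      x<p : x < p
      x<p = ℕ.pred-cancel-< i<p-1
      x+x⁻¹≋z : x+x⁻¹ x ≋ z
      x+x⁻¹≋z = 𝟙≢0⇒ (x+x⁻¹ x ≋? z) Ai≢0
      fi≋x-x⁻¹ : + f i ≋ + x - + inv p x
      fi≋x-x⁻¹ = ≋-sym (≋-residue (+ x - + inv p x))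
      fi²≋z²-4 : + f i * + f i ≋ z * z - + 4
      fi²≋z²-4 = ≋-trans (*-cong fi≋x-x⁻¹ fi≋x-x⁻¹)
                         (difference-square {+ x} {+ inv p x} {z} (inv-correct x (positive-residue-≉0 (ℕ.s≤s ℕ.z≤n) x<p)) x+x⁻¹≋z)
      X≋x : X (f i) ≋ + x
      X≋x = ≋-trans (*-congʳ ½ (+-cong (≋-refl {z}) fi≋x-x⁻¹)) (half-of-sum {+ x} {+ inv p x} {z} x+x⁻¹≋z)

    onB : ∀ m → m < p → B m ≢ 0 → g m < p ∸ 1 × f (g m) ≡ m × A (g m) ≡ B m
    onB m m<p Bm≢0 = ℕ.pred-mono-< {{ℕ.≢-nonZero x≢0}} (residue<p (X m))
                   , trans (cong (λ y → residue (+ y - + inv p y)) suc[gm]≡x)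
                           (trans (residue-cong (≋-trans (+-cong x≋X (-‿cong x⁻¹≋z-X)) (half-sum-difference z (+ m)))) (residue-of-residue m<p))
                   , trans (𝟙-yes (x+x⁻¹ (suc (g m)) ≋? z) on-fibre) (sym (𝟙-yes (+ m * + m ≋? z * z - + 4) m²≋z²-4))
      where
      m²≋z²-4 : + m * + m ≋ z * z - + 4
      m²≋z²-4 = 𝟙≢0⇒ (+ m * + m ≋? z * z - + 4) Bm≢0
      X[z-X]≋1 : X m * (z - X m) ≋ + 1
      X[z-X]≋1 = half-sum-inverse {z} {+ m} m²≋z²-4
      X≉0 : X m ≉ + 0
      X≉0 X≋0 = 1≉0 (≋-trans (≋-sym X[z-X]≋1) (*-≋0ˡ (z - X m) X≋0))
      x : ℕ
      x = residue (X m)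
      x≋X : + x ≋ X m
      x≋X = ≋-sym (≋-residue (X m))
      x≢0 : x ≢ 0
      x≢0 x≡0 = X≉0 (≋-trans (≋-sym x≋X) (≋-reflexive (cong +_ x≡0)))
      suc[gm]≡x : suc (g m) ≡ x
      suc[gm]≡x = ℕ.suc-pred x {{ℕ.≢-nonZero x≢0}}
      x⁻¹≋z-X : + inv p x ≋ z - X m
      x⁻¹≋z-X = inverse-unique {+ x} (inv-correct x (λ x≋0 → X≉0 (≋-trans (≋-sym x≋X) x≋0))) (≋-trans (*-congʳ (z - X m) x≋X) X[z-X]≋1)
      cancel : ∀ a z → a + (z - a) ≡ z
      cancel = solve-∀
      on-fibre : x+x⁻¹ (suc (g m)) ≋ z
      on-fibre = ≋-trans (≋-reflexive (cong x+x⁻¹ suc[gm]≡x)) (≋-trans (+-cong x≋X x⁻¹≋z-X) (≋-reflexive (cancel (X m) z)))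

  ∑-fibreCount : ∀ (F : ℕ → ℤ) → (∀ a → ∑ p (λ u → 𝟙 (a ≋? F u)) ≡ 1) → ∑ p (λ u → fibreCount (F u)) ≡ p ∸ 1
  ∑-fibreCount F hits-once = begin
    ∑ p (λ u → ∑ (p ∸ 1) (λ i → 𝟙 (x+x⁻¹ (suc i) ≋? F u)))   ≡⟨ ∑-comm p (p ∸ 1) _ ⟩
    ∑ (p ∸ 1) (λ i → ∑ p (λ u → 𝟙 (x+x⁻¹ (suc i) ≋? F u)))   ≡⟨ ∑-cong (p ∸ 1) (λ i _ → hits-once (x+x⁻¹ (suc i))) ⟩
    ∑ (p ∸ 1) (λ _ → 1)                                      ≡⟨ ∑-const (p ∸ 1) 1 ⟩
    (p ∸ 1) ℕ.* 1                                            ≡⟨ ℕ.*-identityʳ (p ∸ 1) ⟩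
    p ∸ 1                                                    ∎
    where open ≡-Reasoning

  ∑-𝟙-≋-reflected : ∀ t a → ∑ p (λ u → 𝟙 (a ≋? t - + u)) ≡ 1
  ∑-𝟙-≋-reflected t a = trans (∑-cong p (λ u _ → 𝟙-cong (a ≋? t - + u) (t - a ≋? + u) reflect unreflect)) (∑-𝟙-≋ (t - a))
    where
    involution : ∀ t b → t - (t - b) ≡ b
    involution = solve-∀
    reflect : ∀ {u} → a ≋ t - u → t - a ≋ u
    reflect {u} a≋t-u = ≋-trans (+-cong (≋-refl {t}) (-‿cong a≋t-u)) (≋-reflexive (involution t u))
    unreflect : ∀ {u} → t - a ≋ u → a ≋ t - u
    unreflect {u} t-a≋u = ≋-trans (≋-reflexive (sym (involution t a))) (+-cong (≋-refl {t}) (-‿cong t-a≋u))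

  ∑-𝟙-≋-convolution : ∀ a b t → ∑ p (λ u → 𝟙 (a ≋? + u) ℕ.* 𝟙 (b ≋? t - + u)) ≡ 𝟙 (a + b ≋? t)
  ∑-𝟙-≋-convolution a b t =
    trans (∑-select-residue a (λ u → 𝟙 (b ≋? t - + u))) (𝟙-cong (b ≋? t - + residue a) (a + b ≋? t) sum≋ difference≋)
    where
    t-ra≋t-a : t - + residue a ≋ t - a
    t-ra≋t-a = +-cong (≋-refl {t}) (-‿cong (≋-sym (≋-residue a)))
    cancelˡ : ∀ a t → a + (t - a) ≡ t
    cancelˡ = solve-∀
    cancelʳ : ∀ a b → a + b - a ≡ b
    cancelʳ = solve-∀
    sum≋ : b ≋ t - + residue a → a + b ≋ t
    sum≋ b≋t-ra = ≋-trans (+-cong (≋-refl {a}) (≋-trans b≋t-ra t-ra≋t-a)) (≋-reflexive (cancelˡ a t))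
    difference≋ : a + b ≋ t → b ≋ t - + residue a
    difference≋ a+b≋t = ≋-trans (≋-reflexive (sym (cancelʳ a b)))
                                 (≋-trans (+-cong a+b≋t (≋-refl { - a})) (≋-sym t-ra≋t-a))

  pairCount : ℤ → ℕ
  pairCount t = ∑ (p ∸ 1) (λ i → ∑ (p ∸ 1) (λ j → 𝟙 (x+x⁻¹ (suc i) + x+x⁻¹ (suc j) ≋? t)))

  pairCount-convolution : ∀ t → pairCount t ≡ ∑ p (λ u → fibreCount (+ u) ℕ.* fibreCount (t - + u))
  pairCount-convolution t = sym (begin
    ∑ p (λ u → fibreCount (+ u) ℕ.* fibreCount (t - + u))
      ≡⟨ ∑-cong p (λ u _ → sym (*-distribʳ-∑ (p ∸ 1) (fibreCount (t - + u)) (λ i → A i u))) ⟩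
    ∑ p (λ u → ∑ (p ∸ 1) (λ i → A i u ℕ.* fibreCount (t - + u)))
      ≡⟨ ∑-cong p (λ u _ → ∑-cong (p ∸ 1) (λ i _ → sym (*-distribˡ-∑ (p ∸ 1) (A i u) (λ j → B j u)))) ⟩
    ∑ p (λ u → ∑ (p ∸ 1) (λ i → ∑ (p ∸ 1) (λ j → A i u ℕ.* B j u)))
      ≡⟨ ∑-comm p (p ∸ 1) _ ⟩
    ∑ (p ∸ 1) (λ i → ∑ p (λ u → ∑ (p ∸ 1) (λ j → A i u ℕ.* B j u)))
      ≡⟨ ∑-cong (p ∸ 1) (λ i _ → ∑-comm p (p ∸ 1) _) ⟩
    ∑ (p ∸ 1) (λ i → ∑ (p ∸ 1) (λ j → ∑ p (λ u → A i u ℕ.* B j u)))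
      ≡⟨ ∑-cong (p ∸ 1) (λ i _ → ∑-cong (p ∸ 1) (λ j _ → ∑-𝟙-≋-convolution (x+x⁻¹ (suc i)) (x+x⁻¹ (suc j)) t)) ⟩
    pairCount t ∎)
    where
    open ≡-Reasoning
    A : ℕ → ℕ → ℕ
    A i u = 𝟙 (x+x⁻¹ (suc i) ≋? + u)
    B : ℕ → ℕ → ℕ
    B j u = 𝟙 (x+x⁻¹ (suc j) ≋? t - + u)

  private
    pairSum≟ : ∀ t (q : ℕ × ℕ) → Dec ((proj₁ q ℕ.+ inv p (proj₁ q) ℕ.+ proj₂ q ℕ.+ inv p (proj₂ q)) % p ≡ t % p)
    pairSum≟ t (x , y) = (x ℕ.+ inv p x ℕ.+ y ℕ.+ inv p y) % p ℕ.≟ t % p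

  N≡pairCount : ∀ t → N p t ≡ pairCount (+ t)
  N≡pairCount t = begin
    length (filter (pairSum≟ t) (concatMap row (map suc (upTo (p ∸ 1)))))
      ≡⟨ cong (λ xs → length (filter (pairSum≟ t) (concatMap row xs))) (map-applyUpTo (λ i → i) suc (p ∸ 1)) ⟩
    length (filter (pairSum≟ t) (concatMap row (applyUpTo suc (p ∸ 1))))
      ≡⟨ length-filter-concatMap (pairSum≟ t) row suc (p ∸ 1) ⟩
    ∑ (p ∸ 1) (λ i → length (filter (pairSum≟ t) (row (suc i))))
      ≡⟨ ∑-cong (p ∸ 1) (λ i _ → cong (λ xs → length (filter (pairSum≟ t) xs)) (row-applyUpTo (suc i))) ⟩
    ∑ (p ∸ 1) (λ i → length (filter (pairSum≟ t) (applyUpTo (λ j → (suc i , suc j)) (p ∸ 1))))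
      ≡⟨ ∑-cong (p ∸ 1) (λ i _ → length-filter-applyUpTo (pairSum≟ t) (λ j → (suc i , suc j)) (p ∸ 1)) ⟩
    ∑ (p ∸ 1) (λ i → ∑ (p ∸ 1) (λ j → 𝟙 (pairSum≟ t (suc i , suc j))))
      ≡⟨ ∑-cong (p ∸ 1) (λ i _ → ∑-cong (p ∸ 1) (λ j _ → %-indicator (suc i) (suc j))) ⟩
    pairCount (+ t) ∎
    where
    open ≡-Reasoning
    row : ℕ → List (ℕ × ℕ)
    row x = map (λ y → (x , y)) (nonzeroResidues p)
    row-applyUpTo : ∀ x → row x ≡ applyUpTo (λ j → (x , suc j)) (p ∸ 1)
    row-applyUpTo x = trans (cong (map (λ y → (x , y))) (map-applyUpTo (λ j → j) suc (p ∸ 1)))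
                            (map-applyUpTo suc (λ y → (x , y)) (p ∸ 1))
    sum-as-ℤ : ∀ x y → + (x ℕ.+ inv p x ℕ.+ y ℕ.+ inv p y) ≡ x+x⁻¹ x + x+x⁻¹ y
    sum-as-ℤ x y = begin
      + (x ℕ.+ inv p x ℕ.+ y ℕ.+ inv p y)          ≡⟨ pos-+ (x ℕ.+ inv p x ℕ.+ y) (inv p y) ⟩
      + (x ℕ.+ inv p x ℕ.+ y) + + inv p y          ≡⟨ cong (_+ + inv p y) (pos-+ (x ℕ.+ inv p x) y) ⟩
      + (x ℕ.+ inv p x) + + y + + inv p y          ≡⟨ +-assoc (+ (x ℕ.+ inv p x)) (+ y) (+ inv p y) ⟩
      + (x ℕ.+ inv p x) + (+ y + + inv p y)        ≡⟨ cong (_+ x+x⁻¹ y) (pos-+ x (inv p x)) ⟩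
      x+x⁻¹ x + x+x⁻¹ y                            ∎
    %-indicator : ∀ x y → 𝟙 (pairSum≟ t (x , y)) ≡ 𝟙 (x+x⁻¹ x + x+x⁻¹ y ≋? + t)
    %-indicator x y = 𝟙-cong (pairSum≟ t (x , y)) (x+x⁻¹ x + x+x⁻¹ y ≋? + t)
      (λ eq → ≋-trans (≋-reflexive (sym (sum-as-ℤ x y))) (%≡⇒≋ eq))
      (λ x+y≋t → ≋⇒%≡ (≋-trans (≋-reflexive (sum-as-ℤ x y)) x+y≋t))

  discriminantProduct : ℤ → ℕ → ℤ
  discriminantProduct t u = (+ u * + u - + 4) * ((t - + u) * (t - + u) - + 4)

  discriminantSum : ℤ → ℕ
  discriminantSum t = ∑ p (λ u → sqrtCount (discriminantProduct t u))

  pairCount+2≡discriminantSum : ∀ t → pairCount t ℕ.+ 2 ≡ discriminantSum t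
  pairCount+2≡discriminantSum t = cancel (pairCount t) (p ∸ 1) (discriminantSum t) (begin
    pairCount t ℕ.+ suc (p ∸ 1) ℕ.* 2
      ≡⟨ cong (λ n → pairCount t ℕ.+ n ℕ.* 2) (ℕ.suc-pred p) ⟩
    pairCount t ℕ.+ p ℕ.* 2
      ≡⟨ cong₂ ℕ._+_ (pairCount-convolution t) (sym (∑-const p 2)) ⟩
    ∑ p (λ u → R u ℕ.* R′ u) ℕ.+ ∑ p (λ _ → 2)
      ≡⟨ sym (∑-distrib-+ p (λ u → R u ℕ.* R′ u) (λ _ → 2)) ⟩
    ∑ p (λ u → R u ℕ.* R′ u ℕ.+ 2)
      ≡⟨ ∑-cong p (λ u _ → product-to-sum u) ⟩
    ∑ p (λ u → R u ℕ.+ R′ u ℕ.+ sqrtCount (discriminantProduct t u))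
      ≡⟨ ∑-distrib-+ p (λ u → R u ℕ.+ R′ u) (λ u → sqrtCount (discriminantProduct t u)) ⟩
    ∑ p (λ u → R u ℕ.+ R′ u) ℕ.+ discriminantSum t
      ≡⟨ cong (ℕ._+ discriminantSum t) (∑-distrib-+ p R R′) ⟩
    ∑ p R ℕ.+ ∑ p R′ ℕ.+ discriminantSum t
      ≡⟨ cong (ℕ._+ discriminantSum t) (cong₂ ℕ._+_ (∑-fibreCount +_ ∑-𝟙-≋)
                                                   (∑-fibreCount (λ u → t - + u) (∑-𝟙-≋-reflected t))) ⟩
    (p ∸ 1) ℕ.+ (p ∸ 1) ℕ.+ discriminantSum t ∎)
    where
    open ≡-Reasoning
    R : ℕ → ℕ
    R u = fibreCount (+ u)
    R′ : ℕ → ℕ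
    R′ u = fibreCount (t - + u)
    product-to-sum : ∀ u → R u ℕ.* R′ u ℕ.+ 2 ≡ R u ℕ.+ R′ u ℕ.+ sqrtCount (discriminantProduct t u)
    product-to-sum u = begin
      R u ℕ.* R′ u ℕ.+ 2                                 ≡⟨ cong₂ (λ a b → a ℕ.* b ℕ.+ 2) R≡S R′≡S ⟩
      sqrtCount d ℕ.* sqrtCount d′ ℕ.+ 2                 ≡⟨ sqrtCount-* d d′ ⟩
      sqrtCount d ℕ.+ sqrtCount d′ ℕ.+ sqrtCount (d * d′) ≡⟨ cong₂ (λ a b → a ℕ.+ b ℕ.+ sqrtCount (d * d′)) R≡S R′≡S ⟨
      R u ℕ.+ R′ u ℕ.+ sqrtCount (discriminantProduct t u) ∎
      where
      d : ℤ
      d = + u * + u - + 4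
      d′ : ℤ
      d′ = (t - + u) * (t - + u) - + 4
      R≡S : R u ≡ sqrtCount d
      R≡S = fibreCount-discriminant (+ u)
      R′≡S : R′ u ≡ sqrtCount d′
      R′≡S = fibreCount-discriminant (t - + u)
    regroup : ∀ a n → n ℕ.+ n ℕ.+ (a ℕ.+ 2) ≡ a ℕ.+ suc n ℕ.* 2
    regroup = ℕ-Solver.solve-∀
    cancel : ∀ a n h → a ℕ.+ suc n ℕ.* 2 ≡ n ℕ.+ n ℕ.+ h → a ℕ.+ 2 ≡ h
    cancel a n h eq = ℕ.+-cancelˡ-≡ (n ℕ.+ n) (a ℕ.+ 2) h (trans (regroup a n) eq)

  private
    substitution : ℤ → ℤ → ℕ → ℕ
    substitution T ι u = residue ((+ 4 * + u + + 8 - + 2 * T) * ι)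

    ≋16*inverse : ∀ {T T′ ι} → T * ι ≋ + 1 → T * T′ ≋ + 16 → T′ ≋ + 16 * ι
    ≋16*inverse {T} {T′} {ι} Tι≋1 TT′≋16 = begin
      T′               ≡⟨ *-identityʳ T′ ⟨
      T′ * + 1         ≈⟨ *-congˡ T′ Tι≋1 ⟨
      T′ * (T * ι)     ≡⟨ regroup T T′ ι ⟩
      (T * T′) * ι     ≈⟨ *-congʳ ι TT′≋16 ⟩
      + 16 * ι         ∎
      where
      open SetoidReasoning ≋-setoid
      regroup : ∀ T T′ ι → T′ * (T * ι) ≡ (T * T′) * ι
      regroup = solve-∀

    substitution-inverse : ∀ {T T′ ι ι′} → T * ι ≋ + 1 → T′ * ι′ ≋ + 1 → T * T′ ≋ + 16 →
                              ∀ u → u < p → substitution T′ ι′ (substitution T ι u) ≡ u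
    substitution-inverse {T} {T′} {ι} {ι′} Tι≋1 T′ι′≋1 TT′≋16 u u<p =
      trans (residue-cong chain) (residue-of-residue u<p)
      where
      open SetoidReasoning ≋-setoid
      Y : ℤ
      Y = (+ 4 * + u + + 8 - + 2 * T) * ι
      v≋Y : + substitution T ι u ≋ Y
      v≋Y = ≋-sym (≋-residue Y)
      T′≋16ι : T′ ≋ + 16 * ι
      T′≋16ι = ≋16*inverse {T} {T′} {ι} Tι≋1 TT′≋16
      expand : ∀ u T ι → + 4 * ((+ 4 * u + + 8 - + 2 * T) * ι) + + 8 - + 2 * (+ 16 * ι) ≡ (+ 16 * ι) * u + + 8 * (+ 1 - T * ι)
      expand = solve-∀
      drop : ∀ a b → (a + + 8 * (+ 1 - + 1)) * b ≡ a * b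
      drop = solve-∀
      regroup : ∀ s u ι′ → (s * u) * ι′ ≡ u * (s * ι′)
      regroup = solve-∀
      chain : (+ 4 * + substitution T ι u + + 8 - + 2 * T′) * ι′ ≋ + u
      chain = begin
        (+ 4 * + substitution T ι u + + 8 - + 2 * T′) * ι′
          ≈⟨ *-congʳ ι′ (+-cong (+-cong (*-congˡ (+ 4) v≋Y) (≋-refl {+ 8})) (-‿cong (*-congˡ (+ 2) T′≋16ι))) ⟩
        (+ 4 * Y + + 8 - + 2 * (+ 16 * ι)) * ι′
          ≡⟨ cong (_* ι′) (expand (+ u) T ι) ⟩
        ((+ 16 * ι) * + u + + 8 * (+ 1 - T * ι)) * ι′
          ≈⟨ *-congʳ ι′ (+-cong (≋-refl {(+ 16 * ι) * + u}) (*-congˡ (+ 8) (+-cong (≋-refl {+ 1}) (-‿cong Tι≋1)))) ⟩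
        ((+ 16 * ι) * + u + + 8 * (+ 1 - + 1)) * ι′
          ≡⟨ drop ((+ 16 * ι) * + u) ι′ ⟩
        ((+ 16 * ι) * + u) * ι′
          ≈⟨ *-congʳ ι′ (*-congʳ (+ u) (≋-sym T′≋16ι)) ⟩
        (T′ * + u) * ι′
          ≡⟨ regroup T′ (+ u) ι′ ⟩
        + u * (T′ * ι′)
          ≈⟨ *-congˡ (+ u) T′ι′≋1 ⟩
        + u * + 1
          ≡⟨ *-identityʳ (+ u) ⟩
        + u ∎

    -- With v = (4u + 8 - 2T)/T and T′ = 16/T one has v² - 4 = 16 (u + 2)(u + 2 - T)/T² and
    -- (T′ - v)² - 4 = 16 (2 - u)(2 - u + T)/T², whose product is (16/T²)² (u² - 4)((T - u)² - 4).
    discriminantProduct-substitution : ∀ {T T′ ι} → T * ι ≋ + 1 → T * T′ ≋ + 16 → ∀ u →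
      discriminantProduct T′ (substitution T ι u) ≋ (+ 16 * ι * ι) * (+ 16 * ι * ι) * discriminantProduct T u
    discriminantProduct-substitution {T} {T′} {ι} Tι≋1 TT′≋16 u = begin
      (+ v * + v - + 4) * ((T′ - + v) * (T′ - + v) - + 4)
        ≈⟨ *-cong (+-cong (*-cong v≋Y v≋Y) (-‿cong 4≋4[Tι]²)) (+-cong (*-cong T′-v≋ T′-v≋) (-‿cong 4≋4[Tι]²)) ⟩
      (Y * Y - + 4 * ((T * ι) * (T * ι))) * ((+ 16 * ι - Y) * (+ 16 * ι - Y) - + 4 * ((T * ι) * (T * ι)))
        ≡⟨ identity (+ u) T ι ⟩
      (+ 16 * ι * ι) * (+ 16 * ι * ι) * discriminantProduct T u ∎
      where
      open SetoidReasoning ≋-setoid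
      v : ℕ
      v = substitution T ι u
      Y : ℤ
      Y = (+ 4 * + u + + 8 - + 2 * T) * ι
      v≋Y : + v ≋ Y
      v≋Y = ≋-sym (≋-residue Y)
      T′-v≋ : T′ - + v ≋ + 16 * ι - Y
      T′-v≋ = +-cong (≋16*inverse {T} {T′} {ι} Tι≋1 TT′≋16) (-‿cong v≋Y)
      4≋4[Tι]² : + 4 ≋ + 4 * ((T * ι) * (T * ι))
      4≋4[Tι]² = ≋-sym (*-congˡ (+ 4) (*-cong Tι≋1 Tι≋1))
      identity : ∀ u T ι →
        ((+ 4 * u + + 8 - + 2 * T) * ι * ((+ 4 * u + + 8 - + 2 * T) * ι) - + 4 * ((T * ι) * (T * ι))) *
        ((+ 16 * ι - (+ 4 * u + + 8 - + 2 * T) * ι) * (+ 16 * ι - (+ 4 * u + + 8 - + 2 * T) * ι) - + 4 * ((T * ι) * (T * ι)))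
        ≡ (+ 16 * ι * ι) * (+ 16 * ι * ι) * ((u * u - + 4) * ((T - u) * (T - u) - + 4))
      identity = solve-∀

  discriminantSum-invariant : ∀ T T′ → T * T′ ≋ + 16 → discriminantSum T ≡ discriminantSum T′
  discriminantSum-invariant T T′ TT′≋16 = begin
    ∑ p (λ u → sqrtCount (discriminantProduct T u))
      ≡⟨ ∑-cong p (λ u _ → scaled u) ⟩
    ∑ p (λ u → sqrtCount (discriminantProduct T′ (substitution T ι u)))
      ≡⟨ ∑-reindex p (λ w → sqrtCount (discriminantProduct T′ w)) (substitution T ι) (substitution T′ ι′)
                   (λ u _ → residue<p ((+ 4 * + u + + 8 - + 2 * T) * ι)) (λ w _ → residue<p ((+ 4 * + w + + 8 - + 2 * T′) * ι′))
                   (substitution-inverse {T} {T′} {ι} {ι′} Tι≋1 T′ι′≋1 TT′≋16)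
                   (substitution-inverse {T′} {T} {ι′} {ι} T′ι′≋1 Tι≋1 T′T≋16) ⟩
    ∑ p (λ w → sqrtCount (discriminantProduct T′ w)) ∎
    where
    open ≡-Reasoning
    T′T≋16 : T′ * T ≋ + 16
    T′T≋16 = ≋-trans (≋-reflexive (*-comm T′ T)) TT′≋16
    T≉0 : T ≉ + 0
    T≉0 T≋0 = 16≉0 (≋-trans (≋-sym TT′≋16) (*-≋0ˡ T′ T≋0))
    T′≉0 : T′ ≉ + 0
    T′≉0 T′≋0 = 16≉0 (≋-trans (≋-sym TT′≋16) (*-≋0ʳ T T′≋0))
    ι : ℤ
    ι = proj₁ (inverse T T≉0)
    Tι≋1 : T * ι ≋ + 1
    Tι≋1 = proj₂ (inverse T T≉0)
    ι′ : ℤ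
    ι′ = proj₁ (inverse T′ T′≉0)
    T′ι′≋1 : T′ * ι′ ≋ + 1
    T′ι′≋1 = proj₂ (inverse T′ T′≉0)
    ι≉0 : ι ≉ + 0
    ι≉0 ι≋0 = 1≉0 (≋-trans (≋-sym Tι≋1) (*-≋0ʳ T ι≋0))
    scaled : ∀ u → sqrtCount (discriminantProduct T u) ≡ sqrtCount (discriminantProduct T′ (substitution T ι u))
    scaled u = sym (trans (sqrtCount-cong (discriminantProduct-substitution {T} {T′} {ι} Tι≋1 TT′≋16 u))
                          (sqrtCount-scale (+ 16 * ι * ι) (discriminantProduct T u) (*-≉0 (*-≉0 16≉0 ι≉0) ι≉0)))

  N-invariant : ∀ s t → s ℕ.* t ≡ 16 [mod p ] → N p s ≡ N p t
  N-invariant s t st≡16 = ℕ.+-cancelʳ-≡ 2 (N p s) (N p t) (begin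
    N p s ℕ.+ 2            ≡⟨ cong (ℕ._+ 2) (N≡pairCount s) ⟩
    pairCount (+ s) ℕ.+ 2  ≡⟨ pairCount+2≡discriminantSum (+ s) ⟩
    discriminantSum (+ s)  ≡⟨ discriminantSum-invariant (+ s) (+ t) st≋16 ⟩
    discriminantSum (+ t)  ≡⟨ pairCount+2≡discriminantSum (+ t) ⟨
    pairCount (+ t) ℕ.+ 2  ≡⟨ cong (ℕ._+ 2) (N≡pairCount t) ⟨
    N p t ℕ.+ 2            ∎)
    where
    open ≡-Reasoning
    st≋16 : + s * + t ≋ + 16
    st≋16 = ≋-trans (≋-reflexive (sym (pos-* s t))) (%≡⇒≋ st≡16)

open import Data.Nat using (_*_)
open import Relation.Binary.PropositionalEquality using (cong)

proposition2 : (p : ℕ) → .{{_ : NonZero p}} → Prime p → p % 2 ≡ 1 →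
    (t s : ℕ) → ¬ (t ≡ 0 [mod p ]) → s * t ≡ 16 [mod p ] →
    N p s ≡ N p t [mod p ]
proposition2 p p-prime p-odd t s _ st≡16 = cong (_% p) (JoukowskiCounts.N-invariant p p-prime p-odd s t st≡16)
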